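{- For all positive integers $m$ and $d$, $\beta_{\{2,4,\ldots,2m\}}(d) = \beta_{\{1,2,\ldots,2m\}}(d) + 1$.
   Context: For a set $W$ of positive integers containing at least one even number, $\beta_W(d)$ denotes the largest size of a set $A \subseteq \mathbb{Z}_2^d$ (of distinct elements) which has no subset $B \subseteq A$ with $|B| \in W$ and $\sum_{x\in B} x = 0$. -}

module Defs where

open import Data.Bool using (Bool; false; _xor_)
open import Data.Nat using (ℕ; _*_; _≤_)
open import Data.Vec using (Vec; replicate; zipWith)
open import Data.List using (List; length; foldr)
open import Data.List.Relation.Unary.Unique.Propositional using (Unique)
open import Data.List.Relation.Binary.Sublist.Propositional using (_⊆_)
open import Data.Product using (Σ; _×_; ∃-syntax)
open import Relation.Binary.PropositionalEquality using (_≡_)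
open import Relation.Nullary using (¬_)

Z2 : ℕ → Set
Z2 d = Vec Bool d

0v : (d : ℕ) → Z2 d
0v d = replicate d false

_⊕_ : {d : ℕ} → Z2 d → Z2 d → Z2 d
_⊕_ = zipWith _xor_

Σv : {d : ℕ} → List (Z2 d) → Z2 d
Σv {d} = foldr _⊕_ (0v d)

-- A set A ⊆ Z_2^d of distinct elements is a duplicate-free list; its
-- subsets B are its sublists (which are again duplicate-free).
-- W is a set of positive integers, given as a predicate on ℕ.
NoWZeroSum : (W : ℕ → Set) {d : ℕ} → List (Z2 d) → Set
NoWZeroSum W {d} A = ∀ (B : List (Z2 d)) → B ⊆ A → W (length B) → ¬ (Σv B ≡ 0v d)

IsBeta : (W : ℕ → Set) (d k : ℕ) → Set
IsBeta W d k =
  (Σ (List (Z2 d)) λ A → Unique A × NoWZeroSum W A × length A ≡ k)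
  × (∀ (A : List (Z2 d)) → Unique A → NoWZeroSum W A → length A ≤ k)

Evens : ℕ → ℕ → Set
Evens m n = ∃[ j ] (1 ≤ j × j ≤ m × n ≡ 2 * j)

UpTo : ℕ → ℕ → Set
UpTo m n = 1 ≤ n × n ≤ 2 * m

-- Write Up = {1,…,2m} and Ev = {2,4,…,2m}.  The proof has two parts.
--
-- For every decidable W with 0 ∉ W the number β_W(d) exists:
-- admissibility of a list is decidable (quantify over its sublists by
-- recursion), and by the pigeonhole principle every duplicate-free list
-- of vectors is one of finitely many candidate lists, so a longest
-- admissible candidate exists.
--
-- If A is Up-admissible then 0 ∉ A and 0 ∷ A is
-- Ev-admissible: an even zero-sum subset through 0 leaves an odd zero-sum
-- subset of A.  Conversely if a ∷ B is Ev-admissible then the translate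
-- a + B is Up-admissible: a zero-sum subset a + D of odd size gives the
-- even zero-sum subset {a} ∪ D of a ∷ B, and one of even size gives the
-- zero-sum subset D itself, since translating an even number of vectors
-- leaves their sum unchanged.
module Submission where

open import Defs
open import Data.Bool using (Bool; true; false)
import Data.Bool.Properties as Bool
open import Data.Empty using (⊥-elim)
open import Data.Nat using (ℕ; zero; suc; _≤_; _≤?_; _+_; _*_; z≤n; s≤s)
open import Data.Nat.Properties
  using (≤-refl; ≤-trans; m≤m+n; m≤n+m; n≤1+n; *-monoʳ-≤; *-cancelˡ-≤; *-cancelˡ-<; +-suc; suc-injective)
open import Data.Product using (Σ; _×_; _,_; ∃-syntax)
open import Data.Sum using (_⊎_; inj₁; inj₂)
open import Data.Vec using ([]; _∷_)
import Data.Vec.Properties as Vec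
open import Data.List using (List; []; _∷_; [_]; length; map; filter; cartesianProductWith)
open import Data.List.Properties using (length-map; length-removeAt′)
open import Data.List.Extrema.Nat using (argmax; argmax-all; f[xs]≤f[argmax])
open import Data.List.Membership.Propositional using (_∈_)
open import Data.List.Membership.Propositional.Properties
  using (∈-filter⁺; ∈-cartesianProductWith⁺)
open import Data.List.Relation.Unary.All as All using (All; []; _∷_)
open import Data.List.Relation.Unary.All.Properties using (all-filter)
open import Data.List.Relation.Unary.Any using (here; there; _─_; index)
open import Data.List.Relation.Unary.AllPairs using ([]; _∷_)
open import Data.List.Relation.Unary.Unique.Propositional using (Unique)
import Data.List.Relation.Unary.Unique.Propositional.Properties as Unique
open import Data.List.Relation.Unary.Unique.DecPropositional using (unique?)
open import Data.List.Relation.Binary.Sublist.Propositional using (_⊆_; []; _∷_; _∷ʳ_; from∈)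
open import Relation.Binary.Definitions using (DecidableEquality)
open import Relation.Binary.PropositionalEquality
  using (_≡_; _≢_; refl; sym; trans; cong; cong₂; subst; module ≡-Reasoning)
open import Relation.Nullary using (¬_; Dec)
open import Relation.Nullary.Decidable using (map′; ¬?; _×-dec_; _→-dec_)
open import Relation.Unary using (Decidable)

⊕-self : {d : ℕ} (x : Z2 d) → x ⊕ x ≡ 0v d
⊕-self []      = refl
⊕-self (b ∷ x) = cong₂ _∷_ (Bool.xor-same b) (⊕-self x)

module _ {d : ℕ} where

  ⊕-assoc : (x y z : Z2 d) → (x ⊕ y) ⊕ z ≡ x ⊕ (y ⊕ z)
  ⊕-assoc = Vec.zipWith-assoc Bool.xor-assoc

  ⊕-comm : (x y : Z2 d) → x ⊕ y ≡ y ⊕ x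
  ⊕-comm = Vec.zipWith-comm Bool.xor-comm

  ⊕-identityˡ : (x : Z2 d) → 0v d ⊕ x ≡ x
  ⊕-identityˡ = Vec.zipWith-identityˡ Bool.xor-identityˡ

  ⊕-identityʳ : (x : Z2 d) → x ⊕ 0v d ≡ x
  ⊕-identityʳ = Vec.zipWith-identityʳ Bool.xor-identityʳ

  ⊕-cancelˡ : (a x : Z2 d) → a ⊕ (a ⊕ x) ≡ x
  ⊕-cancelˡ a x = begin
    a ⊕ (a ⊕ x)  ≡⟨ sym (⊕-assoc a a x) ⟩
    (a ⊕ a) ⊕ x  ≡⟨ cong (_⊕ x) (⊕-self a) ⟩
    0v d ⊕ x     ≡⟨ ⊕-identityˡ x ⟩
    x            ∎
    where open ≡-Reasoning

  -- translation by a is injective, so it preserves distinctness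
  ⊕-injective : (a : Z2 d) {x y : Z2 d} → a ⊕ x ≡ a ⊕ y → x ≡ y
  ⊕-injective a {x} {y} e =
    trans (sym (⊕-cancelˡ a x)) (trans (cong (a ⊕_) e) (⊕-cancelˡ a y))

  ⊕-interchange : (a b c e : Z2 d) → (a ⊕ b) ⊕ (c ⊕ e) ≡ (a ⊕ c) ⊕ (b ⊕ e)
  ⊕-interchange a b c e = begin
    (a ⊕ b) ⊕ (c ⊕ e)  ≡⟨ ⊕-assoc a b (c ⊕ e) ⟩
    a ⊕ (b ⊕ (c ⊕ e))  ≡⟨ cong (a ⊕_) (sym (⊕-assoc b c e)) ⟩
    a ⊕ ((b ⊕ c) ⊕ e)  ≡⟨ cong (λ t → a ⊕ (t ⊕ e)) (⊕-comm b c) ⟩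
    a ⊕ ((c ⊕ b) ⊕ e)  ≡⟨ cong (a ⊕_) (⊕-assoc c b e) ⟩
    a ⊕ (c ⊕ (b ⊕ e))  ≡⟨ sym (⊕-assoc a c (b ⊕ e)) ⟩
    (a ⊕ c) ⊕ (b ⊕ e)  ∎
    where open ≡-Reasoning

  _≟_ : DecidableEquality (Z2 d)
  _≟_ = Vec.≡-dec Bool._≟_

double-suc : (j : ℕ) → 2 * suc j ≡ suc (suc (2 * j))
double-suc j = cong suc (+-suc j (j + 0))

module _ {d : ℕ} where

  _·_ : ℕ → Z2 d → Z2 d
  zero  · a = 0v d
  suc n · a = a ⊕ (n · a)

  even-multiple : (j : ℕ) (a : Z2 d) → (2 * j) · a ≡ 0v d
  even-multiple zero    a = refl
  even-multiple (suc j) a = begin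
    (2 * suc j) · a            ≡⟨ cong (_· a) (double-suc j) ⟩
    a ⊕ (a ⊕ ((2 * j) · a))    ≡⟨ ⊕-cancelˡ a _ ⟩
    (2 * j) · a                ≡⟨ even-multiple j a ⟩
    0v d                       ∎
    where open ≡-Reasoning

  translate-sum : (a : Z2 d) (D : List (Z2 d)) →
                  Σv (map (a ⊕_) D) ≡ (length D · a) ⊕ Σv D
  translate-sum a []      = sym (⊕-identityˡ (0v d))
  translate-sum a (x ∷ D) = begin
    (a ⊕ x) ⊕ Σv (map (a ⊕_) D)          ≡⟨ cong ((a ⊕ x) ⊕_) (translate-sum a D) ⟩
    (a ⊕ x) ⊕ ((length D · a) ⊕ Σv D)    ≡⟨ ⊕-interchange a x (length D · a) (Σv D) ⟩
    (a ⊕ (length D · a)) ⊕ (x ⊕ Σv D)    ∎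
    where open ≡-Reasoning

  translate-sum-even : (a : Z2 d) (D : List (Z2 d)) {j : ℕ} → length D ≡ 2 * j →
                       Σv (map (a ⊕_) D) ≡ Σv D
  translate-sum-even a D {j} even = begin
    Σv (map (a ⊕_) D)       ≡⟨ translate-sum a D ⟩
    (length D · a) ⊕ Σv D   ≡⟨ cong (λ n → (n · a) ⊕ Σv D) even ⟩
    ((2 * j) · a) ⊕ Σv D    ≡⟨ cong (_⊕ Σv D) (even-multiple j a) ⟩
    0v d ⊕ Σv D             ≡⟨ ⊕-identityˡ (Σv D) ⟩
    Σv D                    ∎
    where open ≡-Reasoning

  translate-sum-odd : (a : Z2 d) (D : List (Z2 d)) {j : ℕ} → length D ≡ suc (2 * j) →
                      Σv (map (a ⊕_) D) ≡ Σv (a ∷ D)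
  translate-sum-odd a D {j} odd = begin
    Σv (map (a ⊕_) D)                ≡⟨ translate-sum a D ⟩
    (length D · a) ⊕ Σv D            ≡⟨ cong (λ n → (n · a) ⊕ Σv D) odd ⟩
    (a ⊕ ((2 * j) · a)) ⊕ Σv D       ≡⟨ cong (λ t → (a ⊕ t) ⊕ Σv D) (even-multiple j a) ⟩
    (a ⊕ 0v d) ⊕ Σv D                ≡⟨ cong (_⊕ Σv D) (⊕-identityʳ a) ⟩
    a ⊕ Σv D                         ∎
    where open ≡-Reasoning

parity : (n : ℕ) → ∃[ j ] (n ≡ 2 * j ⊎ n ≡ suc (2 * j))
parity zero = 0 , inj₁ refl
parity (suc n) with parity n
... | j , inj₁ even = j , inj₂ (cong suc even)
... | j , inj₂ odd  = suc j , inj₁ (trans (cong suc odd) (sym (double-suc j)))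

UpTo-excludes-0 : (m : ℕ) → ¬ UpTo m 0
UpTo-excludes-0 m (() , _)

UpTo? : (m : ℕ) → Decidable (UpTo m)
UpTo? m n = (1 ≤? n) ×-dec (n ≤? 2 * m)

Evens⇒UpTo : {m n : ℕ} → Evens m n → UpTo m n
Evens⇒UpTo {m} (j , 1≤j , j≤m , refl) = ≤-trans 1≤j (m≤m+n j (j + 0)) , *-monoʳ-≤ 2 j≤m

Evens-suc⇒UpTo : {m n : ℕ} → Evens m (suc n) → UpTo m n
Evens-suc⇒UpTo {m} {n} (suc i , _ , i<m , 2j≡) =
  subst (1 ≤_) (sym n≡) (≤-trans (s≤s z≤n) (m≤n+m (suc (i + 0)) i)) ,
  ≤-trans (n≤1+n n) (subst (_≤ 2 * m) (sym 2j≡) (*-monoʳ-≤ 2 i<m))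
  where
  n≡ : n ≡ i + suc (i + 0)
  n≡ = suc-injective 2j≡

UpTo-even⇒Evens : {m n j : ℕ} → n ≡ 2 * j → UpTo m n → Evens m n
UpTo-even⇒Evens {j = zero}  refl (() , _)
UpTo-even⇒Evens {j = suc j} refl (_ , n≤2m) = suc j , s≤s z≤n , *-cancelˡ-≤ 2 n≤2m , refl

-- an odd size in {1,…,2m} is at most 2m - 1, so one more is still in {2,…,2m}
UpTo-odd⇒Evens : {m n j : ℕ} → n ≡ suc (2 * j) → UpTo m n → Evens m (suc n)
UpTo-odd⇒Evens {m} {j = j} refl (_ , n≤2m) =
  suc j , s≤s z≤n , *-cancelˡ-< 2 j m n≤2m , sym (double-suc j)

module _ {d : ℕ} where

  -- an Up-admissible set does not contain 0, since {0} has size 1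
  zero-free : {m : ℕ} → 1 ≤ m → {A : List (Z2 d)} → NoWZeroSum (UpTo m) A → All (0v d ≢_) A
  zero-free {m} 1≤m adm = All.tabulate λ {y} y∈A 0≡y →
    adm [ y ] (from∈ y∈A) (≤-refl , ≤-trans 1≤m (m≤m+n m (m + 0))) (trans (⊕-identityʳ y) (sym 0≡y))

  -- adjoining 0: an even zero-sum subset through 0 would leave an odd one in A
  zero-extension : {m : ℕ} {A : List (Z2 d)} → NoWZeroSum (UpTo m) A → NoWZeroSum (Evens m) (0v d ∷ A)
  zero-extension adm B       (_ ∷ʳ B⊆A)    ev sum≡0 = adm B B⊆A (Evens⇒UpTo ev) sum≡0
  zero-extension adm (_ ∷ B) (refl ∷ B⊆A) ev sum≡0 =
    adm B B⊆A (Evens-suc⇒UpTo ev) (trans (sym (⊕-identityˡ (Σv B))) sum≡0)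

  sublist-of-map : (f : Z2 d → Z2 d) {D ys : List (Z2 d)} → D ⊆ map f ys →
                   ∃[ D′ ] (D ≡ map f D′ × D′ ⊆ ys)
  sublist-of-map f {ys = []}     []         = [] , refl , []
  sublist-of-map f {ys = y ∷ ys} (_ ∷ʳ D⊆)  with sublist-of-map f D⊆
  ... | D′ , refl , D′⊆ = D′ , refl , y ∷ʳ D′⊆
  sublist-of-map f {ys = y ∷ ys} (refl ∷ D⊆) with sublist-of-map f D⊆
  ... | D′ , refl , D′⊆ = y ∷ D′ , refl , refl ∷ D′⊆

  -- translating the rest of an Ev-admissible list by its head gives an
  -- Up-admissible list: even-sized zero-sum subsets of the translate come
  -- from D itself, odd-sized ones from a ∷ D
  translation : {m : ℕ} {a : Z2 d} {B : List (Z2 d)} →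
                NoWZeroSum (Evens m) (a ∷ B) → NoWZeroSum (UpTo m) (map (a ⊕_) B)
  translation {m} {a} adm D D⊆ size sum≡0 with sublist-of-map (a ⊕_) D⊆
  ... | D′ , refl , D′⊆B with parity (length D′) | subst (UpTo m) (length-map (a ⊕_) D′) size
  ... | j , inj₁ even | size′ =
    adm D′ (a ∷ʳ D′⊆B) (UpTo-even⇒Evens {j = j} even size′)
        (trans (sym (translate-sum-even a D′ {j} even)) sum≡0)
  ... | j , inj₂ odd  | size′ =
    adm (a ∷ D′) (refl ∷ D′⊆B) (UpTo-odd⇒Evens {j = j} odd size′)
        (trans (sym (translate-sum-odd a D′ {j} odd)) sum≡0)

module _ {X : Set} where

  ─-keeps : {x z : X} {ys : List X} (x∈ : x ∈ ys) → z ∈ ys → x ≢ z → z ∈ (ys ─ x∈)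
  ─-keeps (here refl) (here refl) x≢z = ⊥-elim (x≢z refl)
  ─-keeps (here _)    (there z∈)  _   = z∈
  ─-keeps (there _)   (here refl) _   = here refl
  ─-keeps (there x∈)  (there z∈)  x≢z = there (─-keeps x∈ z∈ x≢z)

  pigeonhole : (xs ys : List X) → Unique xs → All (_∈ ys) xs → length xs ≤ length ys
  pigeonhole []       ys _              _           = z≤n
  pigeonhole (x ∷ xs) ys (x∉xs ∷ uniq) (x∈ys ∷ xs⊆) =
    subst (suc (length xs) ≤_) (sym (length-removeAt′ ys (index x∈ys)))
      (s≤s (pigeonhole xs (ys ─ x∈ys) uniq
        (All.zipWith (λ (z∈ , x≢z) → ─-keeps x∈ys z∈ x≢z) (xs⊆ , x∉xs))))

module _ {X : Set} where

  words : ℕ → List X → List (List X)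
  words zero    L = [ [] ]
  words (suc n) L = [] ∷ cartesianProductWith _∷_ L (words n L)

  words-complete : {n : ℕ} (L : List X) (A : List X) → length A ≤ n → All (_∈ L) A → A ∈ words n L
  words-complete {zero}  L []      _          _           = here refl
  words-complete {suc n} L []      _          _           = here refl
  words-complete {suc n} L (x ∷ A) (s≤s |A|≤) (x∈L ∷ A⊆L) =
    there (∈-cartesianProductWith⁺ _∷_ x∈L (words-complete L A |A|≤ A⊆L))

  all-sublists? : {Q : List X → Set} → Decidable Q → (A : List X) → Dec (∀ B → B ⊆ A → Q B)
  all-sublists? {Q} Q? []      = map′ (λ { q .[] [] → q }) (λ h → h [] []) (Q? [])
  all-sublists? {Q} Q? (x ∷ A) =
    map′ combine (λ h → (λ B s → h B (x ∷ʳ s)) , (λ B s → h (x ∷ B) (refl ∷ s)))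
         (all-sublists? Q? A ×-dec all-sublists? (λ B → Q? (x ∷ B)) A)
    where
    combine : (∀ B → B ⊆ A → Q B) × (∀ B → B ⊆ A → Q (x ∷ B)) → ∀ B → B ⊆ x ∷ A → Q B
    combine (skip , _)    B       (_ ∷ʳ s)   = skip B s
    combine (_    , keep) (_ ∷ B) (refl ∷ s) = keep B s

  longest : DecidableEquality X → (univ : List X) → (∀ x → x ∈ univ) →
            (P : List X → Set) → Decidable P → P [] →
            Σ (List X) λ A → (Unique A × P A) × (∀ B → Unique B → P B → length B ≤ length A)
  longest _≟X_ univ complete P P? P[] =
    best , argmax-all length ([] , P[]) (all-filter Q? (words (length univ) univ)) , maximal
    where
    Q : List X → Set
    Q A = Unique A × P A
    Q? : Decidable Q
    Q? A = unique? _≟X_ A ×-dec P? A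
    candidates : List (List X)
    candidates = filter Q? (words (length univ) univ)
    best : List X
    best = argmax length [] candidates
    maximal : ∀ B → Unique B → P B → length B ≤ length best
    maximal B uB pB = All.lookup (f[xs]≤f[argmax] [] candidates)
      (∈-filter⁺ Q? (words-complete univ B (pigeonhole B univ uB B⊆) B⊆) (uB , pB))
      where
      B⊆ : All (_∈ univ) B
      B⊆ = All.tabulate λ {x} _ → complete x

bits : List Bool
bits = true ∷ false ∷ []

allZ2 : (d : ℕ) → List (Z2 d)
allZ2 zero    = [ [] ]
allZ2 (suc d) = cartesianProductWith _∷_ bits (allZ2 d)

allZ2-complete : {d : ℕ} (x : Z2 d) → x ∈ allZ2 d
allZ2-complete []          = here refl
allZ2-complete (true ∷ x)  = ∈-cartesianProductWith⁺ _∷_ {xs = bits} (here refl) (allZ2-complete x)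
allZ2-complete (false ∷ x) = ∈-cartesianProductWith⁺ _∷_ {xs = bits} (there (here refl)) (allZ2-complete x)

NoWZeroSum? : {W : ℕ → Set} → Decidable W → {d : ℕ} → Decidable (NoWZeroSum W {d})
NoWZeroSum? W? {d} = all-sublists? λ B → W? (length B) →-dec ¬? (Σv B ≟ 0v d)

beta-exists : (W : ℕ → Set) → Decidable W → ¬ W 0 → (d : ℕ) → Σ ℕ (IsBeta W d)
beta-exists W W? 0∉W d =
  let A , (uA , admA) , maximal =
        longest _≟_ (allZ2 d) allZ2-complete (NoWZeroSum W) (NoWZeroSum? W?) empty-admissible
  in length A , (A , uA , admA , refl) , maximal
  where
  -- the empty set is admissible because the empty sum has size 0 ∉ W
  empty-admissible : NoWZeroSum W {d} []
  empty-admissible [] [] 0∈W = ⊥-elim (0∉W 0∈W)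

-- The shift by one: adjoining 0 to a largest Up-admissible set gives the
-- lower bound, and translating an Ev-admissible a ∷ B by a gives the upper
-- bound |a ∷ B| = |a + B| + 1 ≤ β_Up(d) + 1.

beta-shift : {m d k : ℕ} → 1 ≤ m → IsBeta (UpTo m) d k → IsBeta (Evens m) d (suc k)
beta-shift {m} {d} {k} 1≤m ((A , uA , admA , |A|≡k) , maximal) =
  (0v d ∷ A , zero-free 1≤m admA ∷ uA , zero-extension admA , cong suc |A|≡k) , bound
  where
  bound : ∀ A′ → Unique A′ → NoWZeroSum (Evens m) A′ → length A′ ≤ suc k
  bound []      _         _    = z≤n
  bound (a ∷ B) (_ ∷ uB) adm = s≤s (subst (_≤ k) (length-map (a ⊕_) B)
    (maximal (map (a ⊕_) B) (Unique.map⁺ (⊕-injective a) uB) (translation adm)))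

theorem3 : (m d : ℕ) → 1 ≤ m → 1 ≤ d →
    Σ ℕ (λ k → IsBeta (UpTo m) d k × IsBeta (Evens m) d (suc k))
theorem3 m d 1≤m _ with beta-exists (UpTo m) (UpTo? m) (UpTo-excludes-0 m) d
... | k , β-up = k , β-up , beta-shift 1≤m β-up
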